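{- Let $n\geq 1$, let $U_{6n}=\langle a,b\mid a^{2n}=b^3=1,\ a^{ -1}ba=b^{ -1}\rangle$, and let $\Gamma=\Gamma(U_{6n})$ be its non-commuting graph. Then the metric dimension of $\Gamma$ is $\beta(\Gamma)=3$ if $n=1$ and $\beta(\Gamma)=5n-4$ if $n>1$.
   Context: The group $U_{6n}$ has order $6n$ and center $Z(U_{6n})=\langle a^2\rangle$. For a finite group $G$, the non-commuting graph $\Gamma(G)$ has vertex set $G\setminus Z(G)$, and two distinct vertices $x,y$ are adjacent iff $xy\neq yx$. For a connected graph $\Gamma$ with distance $d$, and $W=\{w_1,\dots,w_k\}\subseteq V(\Gamma)$, the representation of $v$ is $r(v\mid W)=(d(v,w_1),\dots,d(v,w_k))$; $W$ is a resolving set if distinct vertices have distinct representations. The metric dimension $\beta(\Gamma)$ is the minimum cardinality of a resolving set. -}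

module Defs where

open import Data.Nat using (ℕ; zero; suc; _+_; _*_; _∸_; _≤_; _%_; _≡ᵇ_; NonZero)
open import Data.Nat.DivMod using (_mod_)
open import Data.Nat.Properties using (m*n≢0)
open import Data.Fin using (Fin; toℕ)
open import Data.Product using (_×_; _,_; ∃; Σ-syntax)
open import Data.List using (List; length)
open import Data.List.Membership.Propositional using (_∈_)
open import Data.List.Relation.Unary.All using (All)
open import Data.List.Relation.Unary.Unique.Propositional using (Unique)
open import Data.Bool using (if_then_else_)
open import Relation.Binary.PropositionalEquality using (_≡_; _≢_)
open import Relation.Nullary using (¬_)

-- Concrete model of U_{6n} = ⟨a,b | a^{2n} = b^3 = 1, a^{-1} b a = b^{-1}⟩:
-- every element is uniquely a^i b^j with i ∈ Z_{2n}, j ∈ Z_3; the pair (i , j)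
-- stands for a^i b^j.  From b a = a b^{-1} we get b^j a^k = a^k b^{(-1)^k j}, so
--   (a^i b^j)(a^k b^l) = a^{i+k} b^{(-1)^k j + l}.
U : ℕ → Set
U n = Fin (2 * n) × Fin 3

twist : ℕ → ℕ → ℕ
twist k j = if (k % 2 ≡ᵇ 0) then j else (3 ∸ j)

mul : (n : ℕ) .{{_ : NonZero n}} → U n → U n → U n
mul n (i , j) (k , l) =
  ((toℕ i + toℕ k) mod (2 * n)) {{m*n≢0 2 n}} ,
  ((twist (toℕ k) (toℕ j) + toℕ l) mod 3)

Central : (n : ℕ) .{{_ : NonZero n}} → U n → Set
Central n x = ∀ y → mul n x y ≡ mul n y x

-- Non-commuting graph Γ(U_{6n}): vertices are the non-central elements,
-- distinct x, y adjacent iff xy ≠ yx (such x, y are automatically non-central).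
Vertex : (n : ℕ) .{{_ : NonZero n}} → U n → Set
Vertex n x = ¬ Central n x

Adj : (n : ℕ) .{{_ : NonZero n}} → U n → U n → Set
Adj n x y = x ≢ y × mul n x y ≢ mul n y x

data Walk (n : ℕ) .{{_ : NonZero n}} : U n → U n → ℕ → Set where
  here  : ∀ {x} → Walk n x x zero
  step  : ∀ {x y z k} → Adj n x y → Walk n y z k → Walk n x z (suc k)

Dist : (n : ℕ) .{{_ : NonZero n}} → U n → U n → ℕ → Set
Dist n x y d = Walk n x y d × (∀ m → Walk n x y m → d ≤ m)

Resolving : (n : ℕ) .{{_ : NonZero n}} → List (U n) → Set
Resolving n W =
  Unique W × All (Vertex n) W ×
  (∀ u v → Vertex n u → Vertex n v → u ≢ v →
     ∃ λ w → w ∈ W × ∃ λ d → ∃ λ e → Dist n u w d × Dist n v w e × d ≢ e)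

MetricDim : (n : ℕ) .{{_ : NonZero n}} → ℕ → Set
MetricDim n k =
  (Σ[ W ∈ List (U n) ] (Resolving n W × length W ≡ k)) ×
  (∀ W → Resolving n W → k ≤ length W)

-- The centre of U_{6n} is ⟨a²⟩, and whether two elements commute depends only on
-- their images in the quotient U_{6n}/⟨a²⟩ ≅ S₃, i.e. on (i mod 2, j) for a^i b^j.
-- Consequently the non-central elements fall into four classes, a^{even} b^{±1}
-- (2n elements) and a^{odd} b^j for j = 0, 1, 2 (n elements each), and two of them
-- commute iff they lie in the same class: Γ is the complete multipartite graph
-- K_{2n,n,n,n}, with distance 1 across classes and 2 within a class. Two vertices of
-- one class outside a resolving set W cannot be told apart by W, so W misses at most
-- one vertex per class and |W| ≥ 5n − 4. For n = 1 the three classes of size one are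
-- also indistinguishable from each other, so W misses at most two vertices and
-- |W| ≥ 3. Sets attaining these bounds are exhibited explicitly.

module Submission where

open import Defs
open import Data.Nat using (ℕ; zero; suc; _+_; _*_; _∸_; _≤_; _>_; _%_; _≡ᵇ_; NonZero; z≤n; s≤s; >-nonZero⁻¹)
open import Data.Nat.Properties
  using (_≟_; +-suc; *-suc; +-comm; *-comm; +-mono-≤; ≤-antisym; m*n≢0; m≤n+o⇒m∸n≤o; module ≤-Reasoning)
open import Data.Nat.DivMod using (_mod_; m%n<n; m%n%n≡m%n; [m+kn]%n≡m%n; m<n⇒m%n≡m)
open import Data.Fin as Fin using (Fin; toℕ; cast; combine; remQuot; fromℕ<)
open import Data.Fin.Patterns using (0F; 1F; 2F)
open import Data.Fin.Properties
  using (all?; 0≢1+n; suc-injective; toℕ-fromℕ<; toℕ-cast; toℕ-combine; toℕ-injective; toℕ<n;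
         cast-involutive; combine-remQuot; remQuot-combine)
  renaming (_≟_ to _≟ᶠ_)
open import Data.Product using (_×_; _,_; proj₁; proj₂; ∃; ∃₂)
open import Data.Product.Properties using (≡-dec)
open import Data.Sum using (_⊎_; inj₁; inj₂; [_,_]′)
open import Data.Bool using (true; false; if_then_else_)
open import Data.Unit using (tt)
open import Data.Empty using (⊥-elim)
open import Data.List using (List; []; _∷_; _++_; length; map; filter; allFin; cartesianProductWith)
open import Data.List.Properties using (length-map; length-++; length-++-sucʳ; length-tabulate)
open import Data.List.Membership.Propositional using (_∈_; _∉_; find; lose)
open import Data.List.Membership.Propositional.Properties
  using (∈-∃++; ∈-++⁻; ∈-++⁺ˡ; ∈-++⁺ʳ; ∈-map⁺; ∈-map⁻; ∈-filter⁻; ∈-allFin;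
         ∈-cartesianProductWith⁺; ∈-cartesianProductWith⁻)
import Data.List.Membership.DecPropositional as DecMembership
open import Data.List.Relation.Binary.Subset.Propositional using (_⊆_)
open import Data.List.Relation.Unary.All as All using (All; []; _∷_)
import Data.List.Relation.Unary.All.Properties as All
open import Data.List.Relation.Unary.Any as Any using (Any; here; there)
open import Data.List.Relation.Unary.AllPairs using ([]; _∷_)
open import Data.List.Relation.Unary.Unique.Propositional using (Unique)
import Data.List.Relation.Unary.Unique.Propositional.Properties as Unique
open import Data.List.Relation.Unary.Unique.DecPropositional using (unique?)
open import Relation.Nullary using (¬_; Dec; yes; no; does; ¬?; contradiction)
open import Relation.Nullary.Decidable using (dec-true; dec-false; toWitness; map′; _×-dec_; _⊎-dec_; _→-dec_)
open import Relation.Unary using (Decidable)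
open import Relation.Unary.Properties using (∁?)
open import Relation.Binary.PropositionalEquality
open import Function using (id; _∘_; _⇔_; mk⇔; Equivalence)
import Function.Properties.Equivalence as ⇔

module _ {A : Set} where

  Unique-⊆⇒length≤ : {xs ys : List A} → Unique xs → xs ⊆ ys → length xs ≤ length ys
  Unique-⊆⇒length≤ {[]} _ _ = z≤n
  Unique-⊆⇒length≤ {x ∷ xs} {ys} (x∉xs ∷ unique) xs⊆ys
    with as , bs , refl ← ∈-∃++ (xs⊆ys (here refl)) = begin
      suc (length xs)         ≤⟨ s≤s (Unique-⊆⇒length≤ unique xs⊆as++bs) ⟩
      suc (length (as ++ bs)) ≡⟨ length-++-sucʳ as x bs ⟨
      length (as ++ x ∷ bs)   ∎
    where
    open ≤-Reasoning
    xs⊆as++bs : xs ⊆ as ++ bs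
    xs⊆as++bs {y} y∈xs with ∈-++⁻ as (xs⊆ys (there y∈xs))
    ... | inj₁ y∈as          = ∈-++⁺ˡ y∈as
    ... | inj₂ (here refl)   = ⊥-elim (All.lookup x∉xs y∈xs refl)
    ... | inj₂ (there y∈bs)  = ∈-++⁺ʳ as y∈bs

  ∉-≢ : ∀ {x y} {xs : List A} → x ∉ xs → y ∈ xs → x ≢ y
  ∉-≢ x∉xs y∈xs x≡y = x∉xs (subst (_∈ _) (sym x≡y) y∈xs)

module _ {A B : Set} where

  Unique-map-separating : (f : A → B) {xs : List A} → Unique xs →
    (∀ {x y} → x ∈ xs → y ∈ xs → x ≢ y → f x ≢ f y) → Unique (map f xs)
  Unique-map-separating f {[]} [] _ = []
  Unique-map-separating f {x ∷ xs} (x∉xs ∷ unique) separates =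
    All.map⁺ (All.tabulate λ y∈xs → separates (here refl) (there y∈xs) (All.lookup x∉xs y∈xs))
    ∷ Unique-map-separating f unique λ x∈ y∈ → separates (there x∈) (there y∈)

  length≤-if-separating : (f : A → B) {xs : List A} {ys : List B} → Unique xs →
    (∀ {x y} → x ∈ xs → y ∈ xs → x ≢ y → f x ≢ f y) → (∀ {x} → x ∈ xs → f x ∈ ys) →
    length xs ≤ length ys
  length≤-if-separating f {xs} unique separates into = begin
    length xs           ≡⟨ length-map f xs ⟨
    length (map f xs)   ≤⟨ Unique-⊆⇒length≤ (Unique-map-separating f unique separates) image⊆ys ⟩
    _ ∎
    where
    open ≤-Reasoning
    image⊆ys : map f xs ⊆ _
    image⊆ys fx∈ with _ , x∈ , refl ← ∈-map⁻ f fx∈ = into x∈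

  length-cartesianProductWith : {C : Set} (f : A → B → C) (xs : List A) (ys : List B) →
    length (cartesianProductWith f xs ys) ≡ length xs * length ys
  length-cartesianProductWith f [] ys = refl
  length-cartesianProductWith f (x ∷ xs) ys = begin
    length (map (f x) ys ++ cartesianProductWith f xs ys)
      ≡⟨ length-++ (map (f x) ys) ⟩
    length (map (f x) ys) + length (cartesianProductWith f xs ys)
      ≡⟨ cong₂ _+_ (length-map (f x) ys) (length-cartesianProductWith f xs ys) ⟩
    length ys + length xs * length ys
      ∎
    where open ≡-Reasoning

module _ {A : Set} {P : A → Set} (P? : Decidable P) where

  length-filter+length-filter-∁ : ∀ xs → length (filter P? xs) + length (filter (∁? P?) xs) ≡ length xs
  length-filter+length-filter-∁ [] = refl
  length-filter+length-filter-∁ (x ∷ xs) with does (P? x)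
  ... | true  = cong suc (length-filter+length-filter-∁ xs)
  ... | false = trans (+-suc _ _) (cong suc (length-filter+length-filter-∁ xs))

Residue : Set
Residue = Fin 2 × Fin 3

all-residues? : {P : Residue → Set} → Decidable P → Dec (∀ r → P r)
all-residues? P? = map′ (λ h (p , j) → h p j) (λ h p j → h (p , j)) (all? λ p → all? λ j → P? (p , j))

_≟ᵣ_ : (r s : Residue) → Dec (r ≡ s)
_≟ᵣ_ = ≡-dec _≟ᶠ_ _≟ᶠ_

-- Class 0 is the centre, class 1 consists of the a^{even} b^{±1}, and class 2 + j
-- of the a^{odd} b^j.
classOf : Residue → ℕ
classOf (0F , 0F) = 0
classOf (0F , _)  = 1
classOf (1F , j)  = 2 + toℕ j

ClassesCommute : ℕ → ℕ → Set
ClassesCommute c d = c ≡ 0 ⊎ d ≡ 0 ⊎ c ≡ d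

classesCommute? : ∀ c d → Dec (ClassesCommute c d)
classesCommute? c d = (c ≟ 0) ⊎-dec (d ≟ 0) ⊎-dec (c ≟ d)

classes-differ⇒¬commute : ∀ {c d} → c ≢ 0 → d ≢ 0 → c ≢ d → ¬ ClassesCommute c d
classes-differ⇒¬commute c≢0 _   _   (inj₁ c≡0)         = c≢0 c≡0
classes-differ⇒¬commute _   d≢0 _   (inj₂ (inj₁ d≡0))  = d≢0 d≡0
classes-differ⇒¬commute _   _   c≢d (inj₂ (inj₂ c≡d))  = c≢d c≡d

-- The second coordinate of xy = yx; the first coordinates of xy and yx always agree.
ResiduesCommute : Residue → Residue → Set
ResiduesCommute (p , j) (q , l) =
  (twist (toℕ q) (toℕ j) + toℕ l) mod 3 ≡ (twist (toℕ p) (toℕ l) + toℕ j) mod 3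

residuesCommute? : ∀ r s → Dec (ResiduesCommute r s)
residuesCommute? (p , j) (q , l) = _ ≟ᶠ _

residuesCommute⇔classesCommute : ∀ r s → ResiduesCommute r s ⇔ ClassesCommute (classOf r) (classOf s)
residuesCommute⇔classesCommute r s = mk⇔ (proj₁ (table r s)) (proj₂ (table r s))
  where
  table = toWitness {a? = all-residues? λ r → all-residues? λ s →
    (residuesCommute? r s →-dec classesCommute? (classOf r) (classOf s)) ×-dec
    (classesCommute? (classOf r) (classOf s) →-dec residuesCommute? r s)} tt

otherResidue : Residue → Residue
otherResidue (1F , 0F) = (1F , 1F)
otherResidue _         = (1F , 0F)

otherResidue-classes : ∀ r → classOf r ≢ 0 →
  classOf (otherResidue r) ≢ 0 × classOf (otherResidue r) ≢ classOf r
otherResidue-classes = toWitness {a? = all-residues? λ r →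
  ¬? (classOf r ≟ 0) →-dec
  ¬? (classOf (otherResidue r) ≟ 0) ×-dec ¬? (classOf (otherResidue r) ≟ classOf r)} tt

nonCentralResidues : List Residue
nonCentralResidues = (0F , 1F) ∷ (0F , 2F) ∷ (1F , 0F) ∷ (1F , 1F) ∷ (1F , 2F) ∷ []

Unique-nonCentralResidues : Unique nonCentralResidues
Unique-nonCentralResidues = toWitness {a? = unique? _≟ᵣ_ nonCentralResidues} tt

nonCentralResidues-nonCentral : All (λ r → classOf r ≢ 0) nonCentralResidues
nonCentralResidues-nonCentral = toWitness {a? = All.all? (λ r → ¬? (classOf r ≟ 0)) nonCentralResidues} tt

classOf-nonCentral : ∀ r → classOf r ≢ 0 → classOf r ∈ 1 ∷ 2 ∷ 3 ∷ 4 ∷ []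
classOf-nonCentral = toWitness {a? = all-residues? λ r →
  ¬? (classOf r ≟ 0) →-dec DecMembership._∈?_ _≟_ (classOf r) (1 ∷ 2 ∷ 3 ∷ 4 ∷ [])} tt

∈-nonCentralResidues : ∀ r → classOf r ≢ 0 → r ∈ nonCentralResidues
∈-nonCentralResidues = toWitness {a? = all-residues? λ r →
  ¬? (classOf r ≟ 0) →-dec DecMembership._∈?_ _≟ᵣ_ r nonCentralResidues} tt

b̄ : Residue
b̄ = (0F , 1F)

classOf-injective-except-b̄ : ∀ r s → classOf r ≢ 0 → r ≢ b̄ → s ≢ b̄ → classOf r ≡ classOf s → r ≡ s
classOf-injective-except-b̄ = toWitness {a? = all-residues? λ r → all-residues? λ s →
  ¬? (classOf r ≟ 0) →-dec ¬? (r ≟ᵣ b̄) →-dec ¬? (s ≟ᵣ b̄) →-dec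
  (classOf r ≟ classOf s) →-dec (r ≟ᵣ s)} tt

twist-mod₂ : ∀ m j → twist (toℕ (m mod 2)) j ≡ twist m j
twist-mod₂ m j = cong (λ k → if k ≡ᵇ 0 then j else 3 ∸ j)
  (trans (cong (_% 2) (toℕ-fromℕ< (m%n<n m 2))) (m%n%n≡m%n m 2))

module _ (n : ℕ) .{{_ : NonZero n}} where

  residue : U n → Residue
  residue (i , j) = (toℕ i mod 2 , j)

  class : U n → ℕ
  class x = classOf (residue x)

  commute⇔residuesCommute : ∀ x y → mul n x y ≡ mul n y x ⇔ ResiduesCommute (residue x) (residue y)
  commute⇔residuesCommute (i , j) (k , l)
    rewrite twist-mod₂ (toℕ k) (toℕ j) | twist-mod₂ (toℕ i) (toℕ l) =
    mk⇔ (cong proj₂) (cong₂ _,_ (cong (λ m → (m mod (2 * n)) {{m*n≢0 2 n}}) (+-comm (toℕ i) (toℕ k))))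

  commute⇔classesCommute : ∀ x y → mul n x y ≡ mul n y x ⇔ ClassesCommute (class x) (class y)
  commute⇔classesCommute x y =
    ⇔.trans (commute⇔residuesCommute x y) (residuesCommute⇔classesCommute (residue x) (residue y))

  blockIndex : Fin n → Fin 2 → Fin (2 * n)
  blockIndex t p = cast (*-comm n 2) (combine t p)

  toℕ-blockIndex : ∀ t p → toℕ (blockIndex t p) ≡ toℕ p + toℕ t * 2
  toℕ-blockIndex t p = begin
    toℕ (cast _ (combine t p)) ≡⟨ toℕ-cast _ (combine t p) ⟩
    toℕ (combine t p)          ≡⟨ toℕ-combine t p ⟩
    2 * toℕ t + toℕ p          ≡⟨ +-comm (2 * toℕ t) (toℕ p) ⟩
    toℕ p + 2 * toℕ t          ≡⟨ cong (toℕ p +_) (*-comm 2 (toℕ t)) ⟩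
    toℕ p + toℕ t * 2          ∎
    where open ≡-Reasoning

  blockIndex-mod₂ : ∀ t p → toℕ (blockIndex t p) mod 2 ≡ p
  blockIndex-mod₂ t p = toℕ-injective (begin
    toℕ (toℕ (blockIndex t p) mod 2) ≡⟨ toℕ-fromℕ< _ ⟩
    toℕ (blockIndex t p) % 2         ≡⟨ cong (_% 2) (toℕ-blockIndex t p) ⟩
    (toℕ p + toℕ t * 2) % 2          ≡⟨ [m+kn]%n≡m%n (toℕ p) (toℕ t) 2 ⟩
    toℕ p % 2                        ≡⟨ m<n⇒m%n≡m (toℕ<n p) ⟩
    toℕ p                            ∎)
    where open ≡-Reasoning

  blockIndex-injective : ∀ {t t′ p p′} → blockIndex t p ≡ blockIndex t′ p′ → t ≡ t′
  blockIndex-injective {t} {t′} {p} {p′} eq = cong proj₁ (begin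
    (t , p)                   ≡⟨ remQuot-combine t p ⟨
    remQuot 2 (combine t p)   ≡⟨ cong (remQuot 2) (toℕ-injective combine-eq) ⟩
    remQuot 2 (combine t′ p′) ≡⟨ remQuot-combine t′ p′ ⟩
    (t′ , p′)                 ∎)
    where
    open ≡-Reasoning
    combine-eq : toℕ (combine t p) ≡ toℕ (combine t′ p′)
    combine-eq = trans (sym (toℕ-cast _ (combine t p))) (trans (cong toℕ eq) (toℕ-cast _ (combine t′ p′)))

  blockIndex-surjective : ∀ i → ∃₂ λ t p → blockIndex t p ≡ i
  blockIndex-surjective i = proj₁ tp , proj₂ tp , (begin
    cast _ (combine (proj₁ tp) (proj₂ tp)) ≡⟨ cong (cast _) (combine-remQuot {n} 2 i′) ⟩
    cast _ i′                              ≡⟨ cast-involutive (*-comm n 2) (*-comm 2 n) i ⟩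
    i                                      ∎)
    where
    open ≡-Reasoning
    i′ : Fin (n * 2)
    i′ = cast (*-comm 2 n) i
    tp = remQuot {n} 2 i′

  -- enum t (p , j) = a^{2t+p} b^j.
  enum : Fin n → Residue → U n
  enum t (p , j) = blockIndex t p , j

  residue-enum : ∀ t r → residue (enum t r) ≡ r
  residue-enum t (p , j) = cong (_, j) (blockIndex-mod₂ t p)

  class-enum : ∀ t r → class (enum t r) ≡ classOf r
  class-enum t r = cong classOf (residue-enum t r)

  enum-injective : ∀ {t t′ r r′} → enum t r ≡ enum t′ r′ → t ≡ t′ × r ≡ r′
  enum-injective {t} {t′} {p , j} {p′ , j′} eq =
    blockIndex-injective (cong proj₁ eq) ,
    trans (sym (residue-enum t (p , j))) (trans (cong residue eq) (residue-enum t′ (p′ , j′)))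

  enum-surjective : ∀ x → ∃₂ λ t r → enum t r ≡ x
  enum-surjective (i , j) with t , p , eq ← blockIndex-surjective i = t , (p , j) , cong (_, j) eq

  origin : Fin n
  origin = fromℕ< (>-nonZero⁻¹ n)

  class≡0⇒central : ∀ {x} → class x ≡ 0 → Central n x
  class≡0⇒central {x} c≡0 y = Equivalence.from (commute⇔classesCommute x y) (inj₁ c≡0)

  vertex⇒class≢0 : ∀ {x} → Vertex n x → class x ≢ 0
  vertex⇒class≢0 vertex = vertex ∘ class≡0⇒central

  otherClassVertex : ∀ x → class x ≢ 0 → ∃ λ y → class y ≢ 0 × class y ≢ class x
  otherClassVertex x c≢0 =
    enum origin s ,
    subst (λ c → c ≢ 0 × c ≢ class x) (sym (class-enum origin s)) (otherResidue-classes (residue x) c≢0)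
    where s = otherResidue (residue x)

  class≢0⇒vertex : ∀ {x} → class x ≢ 0 → Vertex n x
  class≢0⇒vertex {x} cx≢0 central with y , cy≢0 , cy≢cx ← otherClassVertex x cx≢0 =
    classes-differ⇒¬commute cx≢0 cy≢0 (cy≢cx ∘ sym)
      (Equivalence.to (commute⇔classesCommute x y) (central y))

  adj⇒classes-differ : ∀ {x y} → Adj n x y → class x ≢ class y
  adj⇒classes-differ {x} {y} (_ , noncommuting) same =
    noncommuting (Equivalence.from (commute⇔classesCommute x y) (inj₂ (inj₂ same)))

  classes-differ⇒adj : ∀ {x y} → x ≢ y → class x ≢ 0 → class y ≢ 0 → class x ≢ class y → Adj n x y
  classes-differ⇒adj {x} {y} x≢y cx≢0 cy≢0 cx≢cy =
    x≢y , classes-differ⇒¬commute cx≢0 cy≢0 cx≢cy ∘ Equivalence.to (commute⇔classesCommute x y)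

  walk₀⇒≡ : ∀ {x y} → Walk n x y 0 → x ≡ y
  walk₀⇒≡ here = refl

  walk₁⇒adj : ∀ {x y} → Walk n x y 1 → Adj n x y
  walk₁⇒adj (step adj here) = adj

  dist-refl : ∀ x → Dist n x x 0
  dist-refl x = here , λ _ _ → z≤n

  dist-adj : ∀ {x y} → Adj n x y → Dist n x y 1
  dist-adj {x} {y} adj = step adj here , shortest
    where
    shortest : ∀ m → Walk n x y m → 1 ≤ m
    shortest zero    walk = ⊥-elim (proj₁ adj (walk₀⇒≡ walk))
    shortest (suc m) _    = s≤s z≤n

  dist-sameClass : ∀ {x y} → x ≢ y → class x ≢ 0 → class x ≡ class y → Dist n x y 2
  dist-sameClass {x} {y} x≢y cx≢0 cx≡cy with z , cz≢0 , cz≢cx ← otherClassVertex x cx≢0 =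
    step x~z (step z~y here) , shortest
    where
    x~z : Adj n x z
    x~z = classes-differ⇒adj (λ x≡z → cz≢cx (cong class (sym x≡z))) cx≢0 cz≢0 (cz≢cx ∘ sym)
    z~y : Adj n z y
    z~y = classes-differ⇒adj (λ z≡y → cz≢cx (trans (cong class z≡y) (sym cx≡cy)))
            cz≢0 (cx≢0 ∘ trans cx≡cy) (λ cz≡cy → cz≢cx (trans cz≡cy (sym cx≡cy)))
    shortest : ∀ m → Walk n x y m → 2 ≤ m
    shortest 0 walk = ⊥-elim (x≢y (walk₀⇒≡ walk))
    shortest 1 walk = ⊥-elim (adj⇒classes-differ (walk₁⇒adj walk) cx≡cy)
    shortest (suc (suc m)) _ = s≤s (s≤s z≤n)

  dist-functional : ∀ {x y d e} → Dist n x y d → Dist n x y e → d ≡ e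
  dist-functional (walk-d , shortest-d) (walk-e , shortest-e) =
    ≤-antisym (shortest-d _ walk-e) (shortest-e _ walk-d)

  dist-differentClass : ∀ {x y} → x ≢ y → class x ≢ 0 → class y ≢ 0 → class x ≢ class y → Dist n x y 1
  dist-differentClass x≢y cx≢0 cy≢0 cx≢cy = dist-adj (classes-differ⇒adj x≢y cx≢0 cy≢0 cx≢cy)

  classTwins-equidistant : ∀ {u v w d e} → u ≢ w → v ≢ w → class u ≢ 0 → class v ≢ 0 → class w ≢ 0 →
    (class u ≡ class w ⇔ class v ≡ class w) → Dist n u w d → Dist n v w e → d ≡ e
  classTwins-equidistant {u} {v} {w} u≢w v≢w cu≢0 cv≢0 cw≢0 twins dist-u dist-v with class u ≟ class w
  ... | yes same  =
    trans (dist-functional dist-u (dist-sameClass u≢w cu≢0 same))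
          (dist-functional (dist-sameClass v≢w cv≢0 (Equivalence.to twins same)) dist-v)
  ... | no differ =
    trans (dist-functional dist-u (dist-differentClass u≢w cu≢0 cw≢0 differ))
          (dist-functional (dist-differentClass v≢w cv≢0 cw≢0 (differ ∘ Equivalence.from twins)) dist-v)

  ClassTwins : List (U n) → U n → U n → Set
  ClassTwins W u v = ∀ {w} → w ∈ W → class u ≡ class w ⇔ class v ≡ class w

  resolving⇒¬classTwins : ∀ {W u v} → Resolving n W → u ∉ W → v ∉ W → u ≢ v →
    class u ≢ 0 → class v ≢ 0 → ¬ ClassTwins W u v
  resolving⇒¬classTwins {u = u} {v} (_ , vertices , resolves) u∉W v∉W u≢v cu≢0 cv≢0 twins =
    let w , w∈W , _ , _ , dist-u , dist-v , d≢e =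
          resolves u v (class≢0⇒vertex {u} cu≢0) (class≢0⇒vertex {v} cv≢0) u≢v
    in d≢e (classTwins-equidistant (∉-≢ u∉W w∈W) (∉-≢ v∉W w∈W) cu≢0 cv≢0
              (vertex⇒class≢0 (All.lookup vertices w∈W)) (twins w∈W) dist-u dist-v)

  resolving⇒outside-classes-differ : ∀ {W u v} → Resolving n W → u ∉ W → v ∉ W → u ≢ v →
    class u ≢ 0 → class v ≢ 0 → class u ≢ class v
  resolving⇒outside-classes-differ resolving u∉W v∉W u≢v cu≢0 cv≢0 same =
    resolving⇒¬classTwins resolving u∉W v∉W u≢v cu≢0 cv≢0 λ _ → mk⇔ (trans (sym same)) (trans same)

  _≟ᵤ_ : (x y : U n) → Dec (x ≡ y)
  _≟ᵤ_ = ≡-dec _≟ᶠ_ _≟ᶠ_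

  open DecMembership _≟ᵤ_ using (_∈?_)

  vertices : List (U n)
  vertices = cartesianProductWith enum (allFin n) nonCentralResidues

  Unique-vertices : Unique vertices
  Unique-vertices =
    Unique.cartesianProductWith⁺ enum enum-injective (Unique.allFin⁺ n) Unique-nonCentralResidues

  length-vertices : length vertices ≡ 5 * n
  length-vertices = begin
    length vertices        ≡⟨ length-cartesianProductWith enum (allFin n) nonCentralResidues ⟩
    length (allFin n) * 5  ≡⟨ cong (_* 5) (length-tabulate {n = n} id) ⟩
    n * 5                  ≡⟨ *-comm n 5 ⟩
    5 * n                  ∎
    where open ≡-Reasoning

  ∈-vertices⇒class≢0 : ∀ {x} → x ∈ vertices → class x ≢ 0
  ∈-vertices⇒class≢0 x∈
    with t , r , _ , r∈ , refl ← ∈-cartesianProductWith⁻ enum (allFin n) nonCentralResidues x∈ =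
    subst (_≢ 0) (sym (class-enum t r)) (All.lookup nonCentralResidues-nonCentral r∈)

  vertex-count-bound : {B : Set} (f : U n → B) (ys : List B) (W : List (U n)) →
    (∀ {u v} → u ∉ W → v ∉ W → u ≢ v → class u ≢ 0 → class v ≢ 0 → f u ≢ f v) →
    (∀ {x} → class x ≢ 0 → f x ∈ ys) →
    5 * n ≤ length W + length ys
  vertex-count-bound f ys W separates into = begin
    5 * n                                ≡⟨ length-vertices ⟨
    length vertices                      ≡⟨ length-filter+length-filter-∁ (_∈? W) vertices ⟨
    length inside + length outside       ≤⟨ +-mono-≤ inside≤W outside≤ys ⟩
    length W + length ys                 ∎
    where
    open ≤-Reasoning
    inside = filter (_∈? W) vertices
    outside = filter (∁? (_∈? W)) vertices
    inside≤W : length inside ≤ length W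
    inside≤W = Unique-⊆⇒length≤ (Unique.filter⁺ (_∈? W) Unique-vertices)
                 (proj₂ ∘ ∈-filter⁻ (_∈? W) {xs = vertices})
    ∈-outside⁻ : ∀ {x} → x ∈ outside → x ∉ W × class x ≢ 0
    ∈-outside⁻ x∈ =
      let x∈V , x∉W = ∈-filter⁻ (∁? (_∈? W)) {xs = vertices} x∈ in x∉W , ∈-vertices⇒class≢0 x∈V
    outside≤ys : length outside ≤ length ys
    outside≤ys = length≤-if-separating f (Unique.filter⁺ (∁? (_∈? W)) Unique-vertices)
      (λ x∈ y∈ x≢y → separates (proj₁ (∈-outside⁻ x∈)) (proj₁ (∈-outside⁻ y∈)) x≢y
                        (proj₂ (∈-outside⁻ x∈)) (proj₂ (∈-outside⁻ y∈)))
      (into ∘ proj₂ ∘ ∈-outside⁻)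

  resolving⇒5n∸4≤length : ∀ {W} → Resolving n W → 5 * n ∸ 4 ≤ length W
  resolving⇒5n∸4≤length {W} resolving = m≤n+o⇒m∸n≤o (5 * n) 4 (begin
    5 * n                ≤⟨ vertex-count-bound class (1 ∷ 2 ∷ 3 ∷ 4 ∷ []) W
                              (resolving⇒outside-classes-differ resolving)
                              (λ {x} → classOf-nonCentral (residue x)) ⟩
    length W + 4         ≡⟨ +-comm (length W) 4 ⟩
    4 + length W         ∎)
    where open ≤-Reasoning

  Separates : List (U n) → U n → U n → Set
  Separates W u v = Any (λ w → class u ≡ class w × class v ≢ class w) W

  ResolvedBy : List (U n) → U n → U n → Set
  ResolvedBy W u v = ∃ λ w → w ∈ W × ∃ λ d → ∃ λ e → Dist n u w d × Dist n v w e × d ≢ e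

  resolvedBy-sym : ∀ {W u v} → ResolvedBy W u v → ResolvedBy W v u
  resolvedBy-sym (w , w∈W , d , e , dist-u , dist-v , d≢e) = w , w∈W , e , d , dist-v , dist-u , d≢e ∘ sym

  dist-positive : ∀ {x y} → x ≢ y → class x ≢ 0 → class y ≢ 0 → ∃ λ d → Dist n x y d × d ≢ 0
  dist-positive {x} {y} x≢y cx≢0 cy≢0 with class x ≟ class y
  ... | yes same  = 2 , dist-sameClass x≢y cx≢0 same , λ ()
  ... | no differ = 1 , dist-differentClass x≢y cx≢0 cy≢0 differ , λ ()

  member-resolves : ∀ {W u v} → u ∈ W → u ≢ v → class u ≢ 0 → class v ≢ 0 → ResolvedBy W u v
  member-resolves {u = u} u∈W u≢v cu≢0 cv≢0 with d , dist-v , d≢0 ← dist-positive (u≢v ∘ sym) cv≢0 cu≢0 =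
    u , u∈W , 0 , d , dist-refl u , dist-v , d≢0 ∘ sym

  separates⇒resolvedBy : ∀ {W u v} → u ∉ W → class u ≢ 0 → class v ≢ 0 →
    Separates W u v → ResolvedBy W u v
  separates⇒resolvedBy u∉W cu≢0 cv≢0 separates with w , w∈W , same , differ ← find separates =
    w , w∈W , 2 , 1 , dist-sameClass (∉-≢ u∉W w∈W) cu≢0 same ,
    dist-differentClass (differ ∘ cong class) cv≢0 (cu≢0 ∘ trans same) differ , λ ()

  separating⇒resolving : ∀ {W} → Unique W → All (λ w → class w ≢ 0) W →
    (∀ {u v} → u ∉ W → v ∉ W → u ≢ v → class u ≢ 0 → class v ≢ 0 → Separates W u v ⊎ Separates W v u) →
    Resolving n W
  separating⇒resolving {W} unique nonCentral separating =
    unique , All.map class≢0⇒vertex nonCentral , resolves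
    where
    resolves : ∀ u v → Vertex n u → Vertex n v → u ≢ v → ResolvedBy W u v
    resolves u v u-vertex v-vertex u≢v = resolve (u ∈? W) (v ∈? W)
      where
      cu≢0 = vertex⇒class≢0 {u} u-vertex
      cv≢0 = vertex⇒class≢0 {v} v-vertex
      resolve : Dec (u ∈ W) → Dec (v ∈ W) → ResolvedBy W u v
      resolve (yes u∈W) _         = member-resolves u∈W u≢v cu≢0 cv≢0
      resolve (no _)    (yes v∈W) = resolvedBy-sym (member-resolves v∈W (u≢v ∘ sym) cv≢0 cu≢0)
      resolve (no u∉W)  (no v∉W)  =
        [ separates⇒resolvedBy u∉W cu≢0 cv≢0 , resolvedBy-sym ∘ separates⇒resolvedBy v∉W cv≢0 cu≢0 ]′
          (separating u∉W v∉W u≢v cu≢0 cv≢0)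

module _ (m : ℕ) where

  private
    n : ℕ
    n = 2 + m

  laterIndices : List (Fin n)
  laterIndices = map Fin.suc (allFin (suc m))

  laterBlocks : List (U n)
  laterBlocks = cartesianProductWith (enum n) laterIndices nonCentralResidues

  -- Of block 0 only b is kept: the omitted vertices b², a, ab, ab² lie in different
  -- classes, and each has a partner of its own class in block 1.
  resolvingSet₂₊ : List (U n)
  resolvingSet₂₊ = enum n 0F b̄ ∷ laterBlocks

  length-resolvingSet₂₊ : length resolvingSet₂₊ ≡ 5 * n ∸ 4
  length-resolvingSet₂₊ = begin
    suc (length laterBlocks)
      ≡⟨ cong suc (length-cartesianProductWith (enum n) laterIndices nonCentralResidues) ⟩
    suc (length laterIndices * 5)
      ≡⟨ cong (λ k → suc (k * 5)) (trans (length-map Fin.suc (allFin (suc m))) (length-tabulate {n = suc m} id)) ⟩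
    suc (suc m * 5)
      ≡⟨ cong suc (*-comm (suc m) 5) ⟩
    suc (5 * suc m)
      ≡⟨ cong (_∸ 4) (*-suc 5 (suc m)) ⟨
    5 * n ∸ 4
      ∎
    where open ≡-Reasoning

  ∈-laterBlocks : ∀ t {r} → r ∈ nonCentralResidues → enum n (Fin.suc t) r ∈ laterBlocks
  ∈-laterBlocks t r∈ = ∈-cartesianProductWith⁺ (enum n) (∈-map⁺ Fin.suc (∈-allFin t)) r∈

  Unique-resolvingSet₂₊ : Unique resolvingSet₂₊
  Unique-resolvingSet₂₊ =
    All.tabulate head∉ ∷
    Unique.cartesianProductWith⁺ (enum n) (enum-injective n)
      (Unique.map⁺ suc-injective (Unique.allFin⁺ (suc m))) Unique-nonCentralResidues
    where
    head∉ : ∀ {x} → x ∈ laterBlocks → enum n 0F b̄ ≢ x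
    head∉ x∈ eq =
      let t , r , t∈ , _ , x≡enum = ∈-cartesianProductWith⁻ (enum n) laterIndices nonCentralResidues x∈
          _ , _ , t≡suc = ∈-map⁻ Fin.suc t∈
      in 0≢1+n (trans (proj₁ (enum-injective n {0F} {t} {b̄} {r} (trans eq x≡enum))) t≡suc)

  resolvingSet₂₊-nonCentral : All (λ w → class n w ≢ 0) resolvingSet₂₊
  resolvingSet₂₊-nonCentral = subst (_≢ 0) (sym (class-enum n 0F b̄)) (λ ()) ∷ All.tabulate later
    where
    later : ∀ {x} → x ∈ laterBlocks → class n x ≢ 0
    later x∈ =
      let t , r , _ , r∈ , x≡enum = ∈-cartesianProductWith⁻ (enum n) laterIndices nonCentralResidues x∈
      in subst (_≢ 0) (sym (trans (cong (class n) x≡enum) (class-enum n t r)))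
           (All.lookup nonCentralResidues-nonCentral r∈)

  outside-resolvingSet₂₊ : ∀ {u} → u ∉ resolvingSet₂₊ → class n u ≢ 0 →
    ∃ λ r → r ≢ b̄ × enum n 0F r ≡ u
  outside-resolvingSet₂₊ {u} u∉W cu≢0 = let t , r , enum≡u = enum-surjective n u in inBlock t r enum≡u
    where
    inBlock : ∀ t r → enum n t r ≡ u → ∃ λ r → r ≢ b̄ × enum n 0F r ≡ u
    inBlock (Fin.suc t) r enum≡u =
      ⊥-elim (u∉W (there (subst (_∈ laterBlocks) enum≡u (∈-laterBlocks t (∈-nonCentralResidues r cr≢0)))))
      where
      cr≢0 = subst (_≢ 0) (trans (cong (class n) (sym enum≡u)) (class-enum n (Fin.suc t) r)) cu≢0
    inBlock 0F r enum≡u = r , (λ r≡b̄ → u∉W (here (trans (sym enum≡u) (cong (enum n 0F) r≡b̄)))) , enum≡u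

  blockZero-separated : ∀ {r s} → classOf r ≢ 0 → classOf s ≢ 0 → r ≢ b̄ → s ≢ b̄ → r ≢ s →
    Separates n resolvingSet₂₊ (enum n 0F r) (enum n 0F s)
  blockZero-separated {r} {s} cr≢0 cs≢0 r≢b̄ s≢b̄ r≢s =
    lose (there (∈-laterBlocks 0F (∈-nonCentralResidues r cr≢0))) (same , differ)
    where
    same : class n (enum n 0F r) ≡ class n (enum n 1F r)
    same = trans (class-enum n 0F r) (sym (class-enum n 1F r))
    differ : class n (enum n 0F s) ≢ class n (enum n 1F r)
    differ eq = r≢s (sym (classOf-injective-except-b̄ s r cs≢0 s≢b̄ r≢b̄
                  (trans (sym (class-enum n 0F s)) (trans eq (class-enum n 1F r)))))

  resolvingSet₂₊-separating : ∀ {u v} → u ∉ resolvingSet₂₊ → v ∉ resolvingSet₂₊ → u ≢ v →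
    class n u ≢ 0 → class n v ≢ 0 → Separates n resolvingSet₂₊ u v ⊎ Separates n resolvingSet₂₊ v u
  resolvingSet₂₊-separating u∉W v∉W u≢v cu≢0 cv≢0 =
    let r , r≢b̄ , enum≡u = outside-resolvingSet₂₊ u∉W cu≢0
        s , s≢b̄ , enum≡v = outside-resolvingSet₂₊ v∉W cv≢0
    in inj₁ (subst₂ (Separates n resolvingSet₂₊) enum≡u enum≡v
         (blockZero-separated (classOf≢0 r enum≡u cu≢0) (classOf≢0 s enum≡v cv≢0) r≢b̄ s≢b̄
           λ r≡s → u≢v (trans (sym enum≡u) (trans (cong (enum n 0F) r≡s) enum≡v))))
    where
    classOf≢0 : ∀ r {x} → enum n 0F r ≡ x → class n x ≢ 0 → classOf r ≢ 0
    classOf≢0 r enum≡x cx≢0 = subst (_≢ 0) (trans (cong (class n) (sym enum≡x)) (class-enum n 0F r)) cx≢0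

  resolving₂₊ : Resolving n resolvingSet₂₊
  resolving₂₊ =
    separating⇒resolving n Unique-resolvingSet₂₊ resolvingSet₂₊-nonCentral resolvingSet₂₊-separating

singleton-classes₁ : ∀ x y → class 1 x ≢ 0 → class 1 x ≢ 1 → class 1 x ≡ class 1 y → x ≡ y
singleton-classes₁ = toWitness {a? = all-residues? λ x → all-residues? λ y →
  ¬? (class 1 x ≟ 0) →-dec ¬? (class 1 x ≟ 1) →-dec
  (class 1 x ≟ class 1 y) →-dec (_≟ᵤ_ 1 x y)} tt

-- Outside W, membership of class 1 separates vertices: two outside vertices not in
-- class 1 lie in singleton classes, so no vertex of W tells them apart.
resolving⇒3≤length₁ : ∀ {W} → Resolving 1 W → 3 ≤ length W
resolving⇒3≤length₁ {W} resolving = m≤n+o⇒m∸n≤o 5 2 (begin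
  5               ≤⟨ vertex-count-bound 1 (λ x → does (class 1 x ≟ 1)) (true ∷ false ∷ []) W
                       separated (λ _ → bool∈) ⟩
  length W + 2    ≡⟨ +-comm (length W) 2 ⟩
  2 + length W    ∎)
  where
  open ≤-Reasoning
  bool∈ : ∀ {b} → b ∈ true ∷ false ∷ []
  bool∈ {true}  = here refl
  bool∈ {false} = there (here refl)
  separated : ∀ {u v} → u ∉ W → v ∉ W → u ≢ v → class 1 u ≢ 0 → class 1 v ≢ 0 →
    does (class 1 u ≟ 1) ≢ does (class 1 v ≟ 1)
  separated {u} {v} u∉W v∉W u≢v cu≢0 cv≢0 same-side with class 1 u ≟ 1 | class 1 v ≟ 1
  ... | yes cu≡1 | yes cv≡1 =
    resolving⇒outside-classes-differ 1 resolving u∉W v∉W u≢v cu≢0 cv≢0 (trans cu≡1 (sym cv≡1))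
  ... | no cu≢1  | no cv≢1  = resolving⇒¬classTwins 1 resolving u∉W v∉W u≢v cu≢0 cv≢0 λ w∈W →
    mk⇔ (λ same → ⊥-elim (∉-≢ u∉W w∈W (singleton-classes₁ u _ cu≢0 cu≢1 same)))
        (λ same → ⊥-elim (∉-≢ v∉W w∈W (singleton-classes₁ v _ cv≢0 cv≢1 same)))
  ... | yes cu≡1 | no cv≢1  = contradiction
    (trans (sym (dec-true (class 1 u ≟ 1) cu≡1)) (trans same-side (dec-false (class 1 v ≟ 1) cv≢1)))
    λ ()
  ... | no cu≢1  | yes cv≡1 = contradiction
    (trans (sym (dec-true (class 1 v ≟ 1) cv≡1)) (trans (sym same-side) (dec-false (class 1 u ≟ 1) cu≢1)))
    λ ()

-- {b, a, ab}: the omitted vertices b² and ab² are separated by b.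
resolvingSet₁ : List (U 1)
resolvingSet₁ = (0F , 1F) ∷ (1F , 0F) ∷ (1F , 1F) ∷ []

resolving₁ : Resolving 1 resolvingSet₁
resolving₁ = separating⇒resolving 1
  (toWitness {a? = unique? (_≟ᵤ_ 1) resolvingSet₁} tt)
  (toWitness {a? = All.all? (λ w → ¬? (class 1 w ≟ 0)) resolvingSet₁} tt)
  (λ {u} {v} → separating u v)
  where
  open DecMembership (_≟ᵤ_ 1) using (_∈?_)
  separates? : ∀ u v → Dec (Separates 1 resolvingSet₁ u v)
  separates? u v =
    Any.any? (λ w → (class 1 u ≟ class 1 w) ×-dec ¬? (class 1 v ≟ class 1 w)) resolvingSet₁
  separating = toWitness {a? = all-residues? λ u → all-residues? λ v →
    ¬? (u ∈? resolvingSet₁) →-dec ¬? (v ∈? resolvingSet₁) →-dec ¬? (_≟ᵤ_ 1 u v) →-dec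
    ¬? (class 1 u ≟ 0) →-dec ¬? (class 1 v ≟ 0) →-dec (separates? u v ⊎-dec separates? v u)} tt

metricDim₁ : MetricDim 1 3
metricDim₁ = (resolvingSet₁ , resolving₁ , refl) , λ W → resolving⇒3≤length₁

metricDim₂₊ : ∀ m → MetricDim (2 + m) (5 * (2 + m) ∸ 4)
metricDim₂₊ m =
  (resolvingSet₂₊ m , resolving₂₊ m , length-resolvingSet₂₊ m) , λ W → resolving⇒5n∸4≤length (2 + m)

theorem3p2 : (n : ℕ) .{{_ : NonZero n}} →
    (n ≡ 1 → MetricDim n 3) × (n > 1 → MetricDim n (5 * n ∸ 4))
theorem3p2 n = (λ { refl → metricDim₁ }) , metricDim>1 n
  where
  metricDim>1 : (n : ℕ) .{{_ : NonZero n}} → n > 1 → MetricDim n (5 * n ∸ 4)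
  metricDim>1 (suc (suc m)) _         = metricDim₂₊ m
  metricDim>1 (suc zero)    (s≤s ())
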